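{- Let $\mathcal{G}$ be a simple temporal clique on $n$ vertices, and let the emitters be defined as below (for any of the arbitrary choices allowed in the construction). Then the number of emitters is at most $n/2$.
   Context: A simple temporal clique is a pair $\mathcal{G}=(G,\lambda)$ where $G=(V,E)$ is the complete graph on a finite vertex set $V$ with $n=|V|\ge 2$, and $\lambda:E\to\mathbb{N}$ assigns each edge a single label such that any two distinct edges sharing an endpoint have distinct labels. For a vertex $v$, $e^-(v)$ denotes the edge incident to $v$ with the smallest label. Let $E^-$ be the set of arcs on $V$ containing, for each vertex $v$ with $e^-(v)=\{u,v\}$, the arc $(u,v)$, except that whenever $e^-(u)=e^-(v)$ for two vertices $u,v$ only one of the arcs $(u,v),(v,u)$ is included (chosen arbitrarily). A sink of $E^-$ is a vertex of out-degree $0$ in $(V,E^-)$. Let $E^-_T$ be obtained from $E^-$ as follows: for every vertex $v$ of out-degree at least $2$ in $E^-$, let $(v,u_1),\dots,(v,u_\ell)$ be its out-arcs where $(v,u_\ell)$ has the largest label; for each $i<\ell$, if $u_i$ is a sink of $E^-$ replace the arc $(v,u_i)$ by $(u_i,v)$, and otherwise delete $(v,u_i)$. The emitters are the vertices of out-degree $0$ in $(V,E^-_T)$. -}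

module Defs where

open import Data.Nat using (ℕ; _≤_; _<_)
open import Data.Fin using (Fin)
open import Data.Fin.Properties using () renaming (_≟_ to _≟ᶠ_)
open import Data.Bool using (Bool; true)
open import Data.Bool.Properties using () renaming (_≟_ to _≟ᵇ_)
open import Data.List using (List; length; filter; allFin)
open import Data.Product using (_×_; ∃)
open import Data.Sum using (_⊎_)
open import Relation.Nullary using (¬_)
open import Relation.Nullary.Decidable using (_×-dec_)
open import Relation.Binary.PropositionalEquality using (_≡_; _≢_)

-- A simple temporal clique on vertex set Fin n: the label of the edge {u,v}
-- (u ≢ v) is lab u v (= lab v u). Values lab v v are meaningless.
record TemporalClique (n : ℕ) : Set where
  field
    lab       : Fin n → Fin n → ℕ
    lab-sym   : ∀ u v → lab u v ≡ lab v u
    lab-local : ∀ u v w → u ≢ v → u ≢ w → v ≢ w → lab u v ≢ lab u w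

module _ {n : ℕ} (G : TemporalClique n) where
  open TemporalClique G

  -- m v is the other endpoint of e⁻(v), the edge at v of minimum label.
  IsMinNeighbour : (Fin n → Fin n) → Set
  IsMinNeighbour m = ∀ v → (m v ≢ v) × (∀ w → w ≢ v → lab v (m v) ≤ lab v w)

  module _ (m : Fin n → Fin n) where
    -- keep v = true iff the arc (m v , v) coming from e⁻(v) is put in E⁻.
    -- Every such arc is kept, except that when e⁻(u) = e⁻(v) (i.e. m u = v
    -- and m v = u) exactly one of (u,v),(v,u) is kept (arbitrary choice).
    ValidChoice : (Fin n → Bool) → Set
    ValidChoice keep =
      (∀ v → m (m v) ≢ v → keep v ≡ true) ×
      (∀ v → m (m v) ≡ v → keep v ≢ keep (m v))

    module _ (keep : Fin n → Bool) where
      EArc : Fin n → Fin n → Set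
      EArc u v = (m v ≡ u) × (keep v ≡ true)

      outdeg : Fin n → ℕ
      outdeg u = length (filter (λ v → (m v ≟ᶠ u) ×-dec (keep v ≟ᵇ true)) (allFin n))

      Sink : Fin n → Set
      Sink u = outdeg u ≡ 0

      ETArc : Fin n → Fin n → Set
      ETArc x y =
        (EArc x y × (outdeg x ≤ 1 ⊎ (∀ z → EArc x z → lab x z ≤ lab x y)))
        ⊎
        (EArc y x × (2 ≤ outdeg y) × (∃ λ z → EArc y z × lab y x < lab y z) × Sink x)

      Emitter : Fin n → Set
      Emitter x = ∀ y → ¬ ETArc x y

module Submission where

-- Every emitter x keeps its in-arc (m x, x) of E⁻, so m x has an out-arc and is not an
-- emitter (its heaviest out-arc survives in E⁻_T), while x itself is a sink of E⁻. If two
-- emitters shared the minimum neighbour u, the lighter of the two arcs leaving u would be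
-- reversed in E⁻_T, giving that emitter an out-arc. So x ↦ m x maps the set of emitters
-- injectively into its complement.

open import Defs
open import Data.Nat using (ℕ; suc; _≤_; _<_; _*_; _+_; _∸_; z≤n; s≤s)
open import Data.Nat.Properties
  using (<-cmp; <⇒≢; m≤n⇒m≤1+n; m≤o∸n⇒m+n≤o; +-identityʳ)
open import Data.Fin using (Fin; suc)
open import Data.Fin.Properties using (0≢1+n)
  renaming (_≟_ to _≟ᶠ_; suc-injective to Fin-suc-injective)
open import Data.Fin.Subset using (Subset; _∈_; ∣_∣; inside; outside; _-_; ∁)
open import Data.Fin.Subset.Properties
  using (p─⊥≡p; x∈p∧x≢y⇒x∈p-y; ∣p∣≤n; ∣∁p∣≡n∸∣p∣; x∉p⇒x∈∁p)
open import Data.Bool using (Bool; true; not)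
open import Data.Bool.Properties using (¬-not) renaming (_≟_ to _≟ᵇ_)
open import Data.Vec using ([]; _∷_; here; there)
open import Data.List using (List; length; filter; allFin)
open import Data.List.Properties using (filter-none)
open import Data.List.Membership.Propositional using () renaming (_∈_ to _∈ˡ_)
open import Data.List.Membership.Propositional.Properties using (∈-allFin; ∈-filter⁺; ∈-length)
open import Data.List.Relation.Unary.Any using () renaming (here to hereˡ; there to thereˡ)
open import Data.List.Relation.Unary.All as All using (All)
open import Data.List.Relation.Unary.All.Properties using (all-filter)
open import Data.List.Extrema.Nat using (argmax; argmax-all; f[xs]≤f[argmax])
open import Data.Product using (_×_; ∃; _,_; proj₁; proj₂)
open import Data.Sum using (inj₁; inj₂)
open import Data.Empty using (⊥-elim)
open import Relation.Nullary using (¬_; yes; no; contradiction)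
open import Relation.Nullary.Decidable using (_×-dec_)
open import Relation.Unary using (Decidable)
open import Relation.Binary using (tri<; tri≈; tri>)
open import Relation.Binary.PropositionalEquality using (_≡_; _≢_; refl; sym; trans; cong; subst)

x∈p⇒∣p∣≡1+∣p-x∣ : ∀ {n} {x : Fin n} {p : Subset n} → x ∈ p → ∣ p ∣ ≡ 1 + ∣ p - x ∣
x∈p⇒∣p∣≡1+∣p-x∣ {p = inside ∷ p} here = cong (λ q → suc ∣ q ∣) (sym (p─⊥≡p p))
x∈p⇒∣p∣≡1+∣p-x∣ (there {y = inside}  x∈p) = cong suc (x∈p⇒∣p∣≡1+∣p-x∣ x∈p)
x∈p⇒∣p∣≡1+∣p-x∣ (there {y = outside} x∈p) = x∈p⇒∣p∣≡1+∣p-x∣ x∈p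

injectiveOn⇒∣p∣≤∣q∣ : ∀ {m n} {p : Subset m} {q : Subset n} (f : Fin m → Fin n) →
                     (∀ {x} → x ∈ p → f x ∈ q) →
                     (∀ {x y} → x ∈ p → y ∈ p → f x ≡ f y → x ≡ y) →
                     ∣ p ∣ ≤ ∣ q ∣
injectiveOn⇒∣p∣≤∣q∣ {p = []} f maps inj = z≤n
injectiveOn⇒∣p∣≤∣q∣ {p = outside ∷ p} f maps inj =
  injectiveOn⇒∣p∣≤∣q∣ (λ x → f (suc x)) (λ x∈p → maps (there x∈p))
    (λ x∈p y∈p fx≡fy → Fin-suc-injective (inj (there x∈p) (there y∈p) fx≡fy))
injectiveOn⇒∣p∣≤∣q∣ {p = inside ∷ p} f maps inj =
  subst (suc ∣ p ∣ ≤_) (sym (x∈p⇒∣p∣≡1+∣p-x∣ (maps here)))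
    (s≤s (injectiveOn⇒∣p∣≤∣q∣ (λ x → f (suc x))
      (λ x∈p → x∈p∧x≢y⇒x∈p-y (maps (there x∈p))
                              (λ fx≡f0 → 0≢1+n (inj here (there x∈p) (sym fx≡f0))))
      (λ x∈p y∈p fx≡fy → Fin-suc-injective (inj (there x∈p) (there y∈p) fx≡fy))))

module _ {A : Set} where

  ∈∧∈∧≢⇒2≤length : ∀ {x y : A} {xs : List A} → x ∈ˡ xs → y ∈ˡ xs → x ≢ y → 2 ≤ length xs
  ∈∧∈∧≢⇒2≤length (hereˡ refl) (hereˡ refl) x≢y = contradiction refl x≢y
  ∈∧∈∧≢⇒2≤length (hereˡ refl) (thereˡ y∈xs) _   = s≤s (∈-length y∈xs)
  ∈∧∈∧≢⇒2≤length (thereˡ x∈xs) (hereˡ refl) _   = s≤s (∈-length x∈xs)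
  ∈∧∈∧≢⇒2≤length (thereˡ x∈xs) (thereˡ y∈xs) x≢y = m≤n⇒m≤1+n (∈∧∈∧≢⇒2≤length x∈xs y∈xs x≢y)

module Emitters {n} (G : TemporalClique n) (m : Fin n → Fin n) (keep : Fin n → Bool) where
  open TemporalClique G

  private
    Arc : Fin n → Fin n → Set
    Arc = EArc G m keep

    Arc? : ∀ u → Decidable (Arc u)
    Arc? u v = (m v ≟ᶠ u) ×-dec (keep v ≟ᵇ true)

    outNeighbours : Fin n → List (Fin n)
    outNeighbours u = filter (Arc? u) (allFin n)

  heaviestOutArc : ∀ {u z} → Arc u z → ∃ λ w → Arc u w × (∀ y → Arc u y → lab u y ≤ lab u w)
  heaviestOutArc {u} {z} u→z = w , argmax-all (lab u) u→z (all-filter (Arc? u) (allFin n)) , heaviest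
    where
      w : Fin n
      w = argmax (lab u) z (outNeighbours u)
      heaviest : ∀ y → Arc u y → lab u y ≤ lab u w
      heaviest y u→y = All.lookup (f[xs]≤f[argmax] z (outNeighbours u))
                                  (∈-filter⁺ (Arc? u) (∈-allFin y) u→y)

  outArc⇒¬Emitter : ∀ {u z} → Arc u z → ¬ Emitter G m keep u
  outArc⇒¬Emitter u→z em with heaviestOutArc u→z
  ... | w , u→w , heaviest = em w (inj₁ (u→w , inj₂ heaviest))

  Emitter⇒Sink : ∀ {x} → Emitter G m keep x → Sink G m keep x
  Emitter⇒Sink {x} em =
    cong length (filter-none (Arc? x) (All.universal (λ _ x→y → outArc⇒¬Emitter x→y em) (allFin n)))

  reversedArc : ∀ {u x y} → Sink G m keep x → Arc u x → Arc u y → lab u x < lab u y →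
                ETArc G m keep x u
  reversedArc {u} {x} {y} sink u→x u→y lighter = inj₂ (u→x , two-out-arcs , (y , u→y , lighter) , sink)
    where
      x≢y : x ≢ y
      x≢y x≡y = <⇒≢ lighter (cong (lab u) x≡y)
      two-out-arcs : 2 ≤ outdeg G m keep u
      two-out-arcs = ∈∧∈∧≢⇒2≤length (∈-filter⁺ (Arc? u) (∈-allFin x) u→x)
                                     (∈-filter⁺ (Arc? u) (∈-allFin y) u→y) x≢y

  module _ (valid : ValidChoice G m keep) where

    Emitter⇒kept : ∀ {x} → Emitter G m keep x → keep x ≡ true
    Emitter⇒kept {x} em with m (m x) ≟ᶠ x
    ... | no  mmx≢x = proj₁ valid x mmx≢x
    -- if the arc (m x, x) was dropped, then (x, m x) was kept
    ... | yes mmx≡x = trans (¬-not (proj₂ valid x mmx≡x))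
                            (cong not (¬-not λ kept → outArc⇒¬Emitter (mmx≡x , kept) em))

    Emitter⇒minNeighbour-¬Emitter : ∀ {x} → Emitter G m keep x → ¬ Emitter G m keep (m x)
    Emitter⇒minNeighbour-¬Emitter em = outArc⇒¬Emitter (refl , Emitter⇒kept em)

    lighterSibling⇒¬Emitter : ∀ {u x y} → Emitter G m keep y → m x ≡ u → m y ≡ u →
                              lab u x < lab u y → ¬ Emitter G m keep x
    lighterSibling⇒¬Emitter em-y mx≡u my≡u lighter em-x =
      em-x _ (reversedArc (Emitter⇒Sink em-x) (mx≡u , Emitter⇒kept em-x)
                                              (my≡u , Emitter⇒kept em-y) lighter)

    emitters-injective : IsMinNeighbour G m → ∀ {x y} → Emitter G m keep x → Emitter G m keep y →
                         m x ≡ m y → x ≡ y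
    emitters-injective m-min {x} {y} em-x em-y mx≡my with x ≟ᶠ y
    ... | yes x≡y = x≡y
    ... | no  x≢y with <-cmp (lab (m x) x) (lab (m x) y)
    ...   | tri< lt _ _ = ⊥-elim (lighterSibling⇒¬Emitter em-y refl (sym mx≡my) lt em-x)
    ...   | tri≈ _ eq _ = ⊥-elim (lab-local (m x) x y (proj₁ (m-min x)) mx≢y x≢y eq)
      where
        mx≢y : m x ≢ y
        mx≢y mx≡y = proj₁ (m-min y) (trans (sym mx≡my) mx≡y)
    ...   | tri> _ _ gt = ⊥-elim (lighterSibling⇒¬Emitter em-x (sym mx≡my) refl gt em-y)

lemma3 : (n : ℕ) → 2 ≤ n → (G : TemporalClique n) →
         (m : Fin n → Fin n) → IsMinNeighbour G m →
         (keep : Fin n → Bool) → ValidChoice G m keep →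
         (S : Subset n) → (∀ x → x ∈ S → Emitter G m keep x) →
         2 * ∣ S ∣ ≤ n
lemma3 n _ G m m-min keep valid S S-emitters =
  subst (_≤ n) (cong (∣ S ∣ +_) (sym (+-identityʳ ∣ S ∣))) (m≤o∸n⇒m+n≤o ∣ S ∣ (∣p∣≤n S) ∣S∣≤∣∁S∣)
  where
    open Emitters G m keep

    m-injectiveOn-S : ∀ {x y} → x ∈ S → y ∈ S → m x ≡ m y → x ≡ y
    m-injectiveOn-S x∈S y∈S = emitters-injective valid m-min (S-emitters _ x∈S) (S-emitters _ y∈S)

    m-maps-S-to-∁S : ∀ {x} → x ∈ S → m x ∈ ∁ S
    m-maps-S-to-∁S x∈S = x∉p⇒x∈∁p λ mx∈S →
      Emitter⇒minNeighbour-¬Emitter valid (S-emitters _ x∈S) (S-emitters _ mx∈S)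

    ∣S∣≤∣∁S∣ : ∣ S ∣ ≤ n ∸ ∣ S ∣
    ∣S∣≤∣∁S∣ = subst (∣ S ∣ ≤_) (∣∁p∣≡n∸∣p∣ S)
                     (injectiveOn⇒∣p∣≤∣q∣ m m-maps-S-to-∁S m-injectiveOn-S)
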